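{- The pruning-enabled perfect phylogenetic tracking algorithm (described in the context) runs in amortized constant time, $\mathcal{O}(1)$, per event; in particular, the removal-handling (pruning) routine takes $\mathcal{O}(1)$ amortized time per removal event.
   Context: Consider an ongoing process in which objects ("organisms") are repeatedly created by replication and removed from the current population; each newly created organism $P_i$ has exactly one parent $P_j$ (asexual replication). The pruning-enabled perfect tracking algorithm maintains a forest $T$ whose nodes record organisms, together with, for each recorded organism, a flag indicating whether it is alive and a counter of its living offspring lineages. It consists of: (1) Initialization, executed once: define $T$ to be an empty forest. (2) Birth handling, executed each time an organism $P_i$ with parent $P_j$ is created: add a node representing $P_i$ to $T$; add an edge in $T$ between $P_i$ and its parent $P_j$; record that $P_i$ is alive; increment $P_j$'s count of living offspring lineages. (3) Removal handling, executed each time an organism $P_i$ is removed from the population: set $P_j \gets$ parent of $P_i$; record that $P_i$ is not alive; then, while $P_i$ is not alive and $P_i$'s count of living offspring lineages equals $0$: remove $P_i$ from $T$, decrement $P_j$'s count of living offspring lineages, set $P_i \gets P_j$, and set $P_j \gets$ parent of $P_j$. Time is measured in the RAM model, counting only the operations of the tracking routines. -}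

module Defs where

open import Data.Nat using (ℕ; zero; suc; _+_; _≡ᵇ_)
open import Data.Bool using (Bool; true; false; if_then_else_; not; _∧_)
open import Data.Maybe using (Maybe; just; nothing)
open import Data.Product using (_×_; _,_; proj₁; proj₂)
open import Data.List using (List; []; _∷_; length)
open import Data.List.Membership.Propositional using (_∈_)
open import Data.Unit using (⊤)
open import Relation.Nullary using (¬_)

-- Organisms are identified by natural numbers.
-- birth i (just j) : organism i is created with parent j.
-- birth i nothing  : a founder organism i is created (no parent;
--                    needed to start the process from an empty forest).
-- removal i        : organism i is removed from the population.

data Event : Set where
  birth   : ℕ → Maybe ℕ → Event
  removal : ℕ → Event

-- Validity of an event sequence (with respect to the population process):
-- a newly created organism has a fresh identifier and its parent is
-- currently alive; a removed organism is currently alive.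
-- 'born' = identifiers ever created, 'living' = current population.

removeAll : ℕ → List ℕ → List ℕ
removeAll i [] = []
removeAll i (k ∷ ks) = if k ≡ᵇ i then removeAll i ks else k ∷ removeAll i ks

ParentOK : Maybe ℕ → List ℕ → Set
ParentOK nothing  living = ⊤
ParentOK (just j) living = j ∈ living

ValidFrom : List ℕ → List ℕ → List Event → Set
ValidFrom born living [] = ⊤
ValidFrom born living (birth i p ∷ es) =
  (¬ (i ∈ born)) × ParentOK p living × ValidFrom (i ∷ born) (i ∷ living) es
ValidFrom born living (removal i ∷ es) =
  (i ∈ living) × ValidFrom born (removeAll i living) es

Valid : List Event → Set
Valid es = ValidFrom [] [] es

-- Each node records
-- the parent pointer, the alive flag and the count of living offspring
-- lineages.

record Node : Set where
  constructor node
  field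
    parent : Maybe ℕ
    alive  : Bool
    count  : ℕ

Forest : Set
Forest = List (ℕ × Node)

lookupN : ℕ → Forest → Maybe Node
lookupN i [] = nothing
lookupN i ((k , n) ∷ t) = if k ≡ᵇ i then just n else lookupN i t

modifyN : ℕ → (Node → Node) → Forest → Forest
modifyN i f [] = []
modifyN i f ((k , n) ∷ t) =
  if k ≡ᵇ i then (k , f n) ∷ modifyN i f t else (k , n) ∷ modifyN i f t

deleteN : ℕ → Forest → Forest
deleteN i [] = []
deleteN i ((k , n) ∷ t) = if k ≡ᵇ i then deleteN i t else (k , n) ∷ deleteN i t

parentOf : ℕ → Forest → Maybe ℕ
parentOf i t with lookupN i t
... | nothing = nothing
... | just n  = Node.parent n

incCount : Node → Node
incCount (node p a c) = node p a (suc c)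

decCount : Node → Node
decCount (node p a c) = node p a (Data.Nat.pred c)

markDead : Node → Node
markDead (node p a c) = node p false c

-- "P_i is not alive and P_i's count of living offspring lineages is 0"
-- (false if P_i is not a recorded node).
prunable : ℕ → Forest → Bool
prunable i t with lookupN i t
... | nothing = false
... | just (node p a c) = not a ∧ (c ≡ᵇ 0)

onMaybe : Maybe ℕ → (Node → Node) → Forest → Forest
onMaybe nothing  f t = t
onMaybe (just j) f t = modifyN j f t

-- Execution with operation counting (RAM model, counting only the
-- primitive operations of the tracking routines).

-- Birth handling: add node, add edge, record alive, increment parent's
-- counter: 4 primitive operations.
birthStep : ℕ → Maybe ℕ → Forest → Forest × ℕ
birthStep i p t = ((i , node p true 0) ∷ onMaybe p incCount t) , 4

-- Each test of the loop condition costs 1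
-- operation; each iteration of the body (remove P_i, decrement P_j's
-- counter, P_i ← P_j, P_j ← parent of P_j) costs 4 operations.
-- When P_j does not exist (P_i was a founder) the loop ends after
-- removing P_i. The fuel argument bounds the number of iterations by
-- the (finite) size of T plus one; each iteration deletes a node.
pruneLoop : ℕ → ℕ → Maybe ℕ → Forest → Forest × ℕ
pruneLoop zero    i pj t = t , 0
pruneLoop (suc f) i pj t with prunable i t
... | false = t , 1
... | true with onMaybe pj decCount (deleteN i t)
...   | t' with pj
...     | nothing = t' , 5
...     | just j with pruneLoop f j (parentOf j t') t'
...       | (t'' , c) = t'' , (5 + c)

-- Removal handling: P_j ← parent of P_i; record P_i not alive (2 ops),
-- followed by the while loop.
removalStep : ℕ → Forest → Forest × ℕ
removalStep i t with modifyN i markDead t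
... | t₁ with pruneLoop (suc (length t₁)) i (parentOf i t) t₁
...   | (t₂ , c) = t₂ , (2 + c)

step : Event → Forest → Forest × ℕ
step (birth i p) t = birthStep i p t
step (removal i) t = removalStep i t

totalCostFrom : Forest → List Event → ℕ
totalCostFrom t [] = 0
totalCostFrom t (e ∷ es) = proj₂ (step e t) + totalCostFrom (proj₁ (step e t)) es

removalCostFrom : Forest → List Event → ℕ
removalCostFrom t [] = 0
removalCostFrom t (birth i p ∷ es) = removalCostFrom (proj₁ (birthStep i p t)) es
removalCostFrom t (removal i ∷ es) =
  proj₂ (removalStep i t) + removalCostFrom (proj₁ (removalStep i t)) es

totalCost : List Event → ℕ
totalCost = totalCostFrom []

removalCost : List Event → ℕ
removalCost = removalCostFrom []

numRemovals : List Event → ℕ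
numRemovals [] = 0
numRemovals (birth i p ∷ es) = numRemovals es
numRemovals (removal i ∷ es) = suc (numRemovals es)

-- Potential argument: give every dead node recorded in T a credit of 5
-- operations. A birth adds a living node and so creates no credit; a removal
-- kills one node (identifiers are fresh, so exactly one entry of T), paying
-- for at most one new credit; each iteration of the pruning loop deletes a
-- dead node and spends its credit, so the loop costs only its final test.
-- Every event thus has amortised cost at most 8.
module Submission where

open import Defs
import Algebra.Properties.CommutativeSemigroup as CommutativeSemigroupProperties
open import Data.Bool using (true; false; T; if_then_else_)
open import Data.List using (List; []; _∷_; map; filter; length)
open import Data.List.Membership.Propositional using (_∈_; _∉_)
open import Data.List.Relation.Binary.Subset.Propositional using (_⊆_)
open import Data.List.Relation.Binary.Subset.Propositional.Properties using (filter-⊆)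
import Data.List.Relation.Unary.All as All
open import Data.List.Relation.Unary.AllPairs using ([]; _∷_)
open import Data.List.Relation.Unary.Any using (here; there)
open import Data.List.Relation.Unary.Unique.Propositional using (Unique)
open import Data.List.Relation.Unary.Unique.Propositional.Properties
  using (filter⁺; Unique[x∷xs]⇒x∉xs)
open import Data.Maybe using (just; nothing)
open import Data.Nat using (ℕ; zero; suc; _+_; _*_; _≤_; _<_; _≡ᵇ_; z≤n; s≤s)
open import Data.Nat.Properties
open import Data.Product using (Σ; _×_; _,_; proj₁; proj₂)
open import Data.Unit using (tt)
open import Function using (_∘_)
open import Relation.Binary.PropositionalEquality
open import Relation.Nullary.Decidable using (¬?; dec-false)

≡ᵇ-true⇒≡ : ∀ {m n} → (m ≡ᵇ n) ≡ true → m ≡ n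
≡ᵇ-true⇒≡ {m} {n} eq = ≡ᵇ⇒≡ m n (subst T (sym eq) tt)

keys : Forest → List ℕ
keys = map proj₁

keys-modifyN : ∀ i f t → keys (modifyN i f t) ≡ keys t
keys-modifyN i f [] = refl
keys-modifyN i f ((k , n) ∷ t) with k ≡ᵇ i
... | true  = cong (k ∷_) (keys-modifyN i f t)
... | false = cong (k ∷_) (keys-modifyN i f t)

keys-onMaybe : ∀ p f t → keys (onMaybe p f t) ≡ keys t
keys-onMaybe nothing  f t = refl
keys-onMaybe (just j) f t = keys-modifyN j f t

keys-deleteN : ∀ i t → keys (deleteN i t) ≡ filter (λ k → ¬? (k ≟ i)) (keys t)
keys-deleteN i [] = refl
keys-deleteN i ((k , n) ∷ t) with k ≡ᵇ i
... | true  = keys-deleteN i t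
... | false = cong (k ∷_) (keys-deleteN i t)

modifyN-fresh : ∀ i f t → i ∉ keys t → modifyN i f t ≡ t
modifyN-fresh i f [] i∉t = refl
modifyN-fresh i f ((k , n) ∷ t) i∉kt
  rewrite dec-false (k ≟ i) (λ k≡i → i∉kt (here (sym k≡i)))
  = cong ((k , n) ∷_) (modifyN-fresh i f t (i∉kt ∘ there))

WellKeyed : List ℕ → Forest → Set
WellKeyed born t = Unique (keys t) × keys t ⊆ born

wellKeyed-onMaybe : ∀ {born} p f t → WellKeyed born t → WellKeyed born (onMaybe p f t)
wellKeyed-onMaybe {born} p f t =
  subst (λ ks → Unique ks × ks ⊆ born) (sym (keys-onMaybe p f t))

wellKeyed-deleteN : ∀ {born} i t → WellKeyed born t → WellKeyed born (deleteN i t)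
wellKeyed-deleteN {born} i t (unique , ⊆born) rewrite keys-deleteN i t =
  filter⁺ P? unique , λ k∈ → ⊆born (filter-⊆ P? (keys t) k∈)
  where P? = λ k → ¬? (k ≟ i)

wellKeyed-pruneLoop : ∀ {born} f i pj t → WellKeyed born t →
                      WellKeyed born (proj₁ (pruneLoop f i pj t))
wellKeyed-pruneLoop zero i pj t wk = wk
wellKeyed-pruneLoop (suc f) i pj t wk with prunable i t
... | false = wk
... | true with pj
...   | nothing = wellKeyed-deleteN i t wk
...   | just j  = wellKeyed-pruneLoop f j _ _
                    (wellKeyed-onMaybe (just j) decCount _ (wellKeyed-deleteN i t wk))

wellKeyed-removalStep : ∀ {born} i t → WellKeyed born t →
                        WellKeyed born (proj₁ (removalStep i t))
wellKeyed-removalStep i t wk =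
  wellKeyed-pruneLoop (suc (length (modifyN i markDead t))) i (parentOf i t) _
                      (wellKeyed-onMaybe (just i) markDead t wk)

wellKeyed-birthStep : ∀ {born} i p t → i ∉ born → WellKeyed born t →
                      WellKeyed (i ∷ born) (proj₁ (birthStep i p t))
wellKeyed-birthStep {born} i p t i∉born wk
  with wellKeyed-onMaybe p incCount t wk
... | unique , ⊆born =
  All.tabulate (λ k∈ i≡k → i∉born (subst (_∈ born) (sym i≡k) (⊆born k∈))) ∷ unique ,
  λ { (here refl) → here refl ; (there k∈) → there (⊆born k∈) }

deadCount : Forest → ℕ
deadCount [] = 0
deadCount ((k , n) ∷ t) = if Node.alive n then deadCount t else suc (deadCount t)

deadCount-modifyN : ∀ i f t → (∀ n → Node.alive (f n) ≡ Node.alive n) →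
                    deadCount (modifyN i f t) ≡ deadCount t
deadCount-modifyN i f [] keepsAlive = refl
deadCount-modifyN i f ((k , n) ∷ t) keepsAlive with k ≡ᵇ i
... | true  rewrite keepsAlive n | deadCount-modifyN i f t keepsAlive = refl
... | false rewrite deadCount-modifyN i f t keepsAlive = refl

deadCount-markDead : ∀ i t → Unique (keys t) →
                     deadCount (modifyN i markDead t) ≤ suc (deadCount t)
deadCount-markDead i [] unique = z≤n
deadCount-markDead i ((k , n) ∷ t) unique@(_ ∷ uniqueₜ) with k ≡ᵇ i in k≡ᵇi
... | true with refl ← ≡ᵇ-true⇒≡ {k} {i} k≡ᵇi
  rewrite modifyN-fresh k markDead t (Unique[x∷xs]⇒x∉xs unique) with Node.alive n
...   | true  = ≤-refl
...   | false = n≤1+n _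
deadCount-markDead i ((k , n) ∷ t) (_ ∷ uniqueₜ) | false with Node.alive n
...   | true  = deadCount-markDead i t uniqueₜ
...   | false = s≤s (deadCount-markDead i t uniqueₜ)

deadCount-deleteN : ∀ i t → deadCount (deleteN i t) ≤ deadCount t
deadCount-deleteN i [] = z≤n
deadCount-deleteN i ((k , n) ∷ t) with k ≡ᵇ i
... | true with Node.alive n
...   | true  = deadCount-deleteN i t
...   | false = m≤n⇒m≤1+n (deadCount-deleteN i t)
deadCount-deleteN i ((k , n) ∷ t) | false with Node.alive n
...   | true  = deadCount-deleteN i t
...   | false = s≤s (deadCount-deleteN i t)

deadCount-deleteN-dead : ∀ i t n → lookupN i t ≡ just n → Node.alive n ≡ false →
                         deadCount (deleteN i t) < deadCount t
deadCount-deleteN-dead i ((k , m) ∷ t) n found dead with k ≡ᵇ i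
deadCount-deleteN-dead i ((k , m) ∷ t) n refl dead | true rewrite dead =
  s≤s (deadCount-deleteN i t)
... | false with Node.alive m
...   | true  = deadCount-deleteN-dead i t n found dead
...   | false = s≤s (deadCount-deleteN-dead i t n found dead)

deadCount-deleteN-prunable : ∀ i t → prunable i t ≡ true →
                             deadCount (deleteN i t) < deadCount t
deadCount-deleteN-prunable i t pr with lookupN i t in found
... | just (node p false c) = deadCount-deleteN-dead i t _ found refl

potential : Forest → ℕ
potential t = 5 * deadCount t

potential-deleteN-prunable : ∀ i t → prunable i t ≡ true →
                             5 + potential (deleteN i t) ≤ potential t
potential-deleteN-prunable i t pr = begin
  5 + 5 * deadCount (deleteN i t) ≡⟨ *-suc 5 _ ⟨
  5 * suc (deadCount (deleteN i t)) ≤⟨ *-monoʳ-≤ 5 (deadCount-deleteN-prunable i t pr) ⟩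
  5 * deadCount t                   ∎
  where open ≤-Reasoning

pruneLoop-amortised : ∀ f i pj t →
  proj₂ (pruneLoop f i pj t) + potential (proj₁ (pruneLoop f i pj t)) ≤ 1 + potential t
pruneLoop-amortised zero i pj t = n≤1+n _
pruneLoop-amortised (suc f) i pj t with prunable i t in pr
... | false = ≤-refl
... | true with pj
...   | nothing = m≤n⇒m≤1+n (potential-deleteN-prunable i t pr)
...   | just j  = begin
  5 + c + potential t″      ≡⟨ +-assoc 5 c _ ⟩
  5 + (c + potential t″)    ≤⟨ +-monoʳ-≤ 5 (pruneLoop-amortised f j (parentOf j t′) t′) ⟩
  5 + (1 + potential t′)    ≡⟨ cong (λ d → 5 + (1 + 5 * d))
                                 (deadCount-modifyN j decCount (deleteN i t) (λ _ → refl)) ⟩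
  1 + (5 + potential (deleteN i t)) ≤⟨ +-monoʳ-≤ 1 (potential-deleteN-prunable i t pr) ⟩
  1 + potential t           ∎
  where
  open ≤-Reasoning
  t′ = modifyN j decCount (deleteN i t)
  c  = proj₂ (pruneLoop f j (parentOf j t′) t′)
  t″ = proj₁ (pruneLoop f j (parentOf j t′) t′)

removalStep-amortised : ∀ i t → Unique (keys t) →
  proj₂ (removalStep i t) + potential (proj₁ (removalStep i t)) ≤ 8 + potential t
removalStep-amortised i t unique = begin
  2 + c + potential t₂      ≡⟨ +-assoc 2 c _ ⟩
  2 + (c + potential t₂)    ≤⟨ +-monoʳ-≤ 2 (pruneLoop-amortised fuel i (parentOf i t) t₁) ⟩
  3 + 5 * deadCount t₁      ≤⟨ +-monoʳ-≤ 3 (*-monoʳ-≤ 5 (deadCount-markDead i t unique)) ⟩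
  3 + 5 * suc (deadCount t) ≡⟨ cong (3 +_) (*-suc 5 _) ⟩
  8 + potential t           ∎
  where
  open ≤-Reasoning
  t₁   = modifyN i markDead t
  fuel = suc (length t₁)
  c    = proj₂ (pruneLoop fuel i (parentOf i t) t₁)
  t₂   = proj₁ (pruneLoop fuel i (parentOf i t) t₁)

potential-birthStep : ∀ i p t → potential (proj₁ (birthStep i p t)) ≡ potential t
potential-birthStep i nothing  t = refl
potential-birthStep i (just j) t =
  cong (5 *_) (deadCount-modifyN j incCount t (λ _ → refl))

birthStep-amortised : ∀ i p t →
  proj₂ (birthStep i p t) + potential (proj₁ (birthStep i p t)) ≤ 8 + potential t
birthStep-amortised i p t rewrite potential-birthStep i p t =
  +-monoˡ-≤ (potential t) (m≤m+n 4 4)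

amortise : ∀ {c r K L Φ Φ′} → c + Φ′ ≤ K + Φ → r ≤ L + Φ′ → c + r ≤ K + L + Φ
amortise {c} {r} {K} {L} {Φ} {Φ′} step rest = begin
  c + r         ≤⟨ +-monoʳ-≤ c rest ⟩
  c + (L + Φ′)  ≡⟨ x∙yz≈y∙xz c L Φ′ ⟩
  L + (c + Φ′)  ≤⟨ +-monoʳ-≤ L step ⟩
  L + (K + Φ)   ≡⟨ x∙yz≈yx∙z L K Φ ⟩
  K + L + Φ     ∎
  where
  open ≤-Reasoning
  open CommutativeSemigroupProperties +-commutativeSemigroup
    using (x∙yz≈y∙xz; x∙yz≈yx∙z)

totalCostFrom-bound : ∀ {born living} t es → WellKeyed born t → ValidFrom born living es →
                      totalCostFrom t es ≤ length es * 8 + potential t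
totalCostFrom-bound t [] wk valid = z≤n
totalCostFrom-bound t (birth i p ∷ es) wk (i∉born , _ , valid) =
  amortise {K = 8} {L = length es * 8} (birthStep-amortised i p t)
    (totalCostFrom-bound (proj₁ (birthStep i p t)) es
                         (wellKeyed-birthStep i p t i∉born wk) valid)
totalCostFrom-bound t (removal i ∷ es) wk (_ , valid) =
  amortise {K = 8} {L = length es * 8} (removalStep-amortised i t (proj₁ wk))
    (totalCostFrom-bound (proj₁ (removalStep i t)) es (wellKeyed-removalStep i t wk) valid)

removalCostFrom-bound : ∀ {born living} t es → WellKeyed born t → ValidFrom born living es →
                        removalCostFrom t es ≤ numRemovals es * 8 + potential t
removalCostFrom-bound t [] wk valid = z≤n
removalCostFrom-bound t (birth i p ∷ es) wk (i∉born , _ , valid) =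
  subst (removalCostFrom t′ es ≤_) (cong (numRemovals es * 8 +_) (potential-birthStep i p t))
    (removalCostFrom-bound t′ es (wellKeyed-birthStep i p t i∉born wk) valid)
  where t′ = proj₁ (birthStep i p t)
removalCostFrom-bound t (removal i ∷ es) wk (_ , valid) =
  amortise {K = 8} {L = numRemovals es * 8} (removalStep-amortised i t (proj₁ wk))
    (removalCostFrom-bound (proj₁ (removalStep i t)) es (wellKeyed-removalStep i t wk) valid)

theorem3 : Σ ℕ (λ C → (es : List Event) → Valid es →
             (totalCost es ≤ C * length es) × (removalCost es ≤ C * numRemovals es))
theorem3 = 8 , λ es valid →
  linear (length es) (totalCostFrom-bound [] es emptyWellKeyed valid) ,
  linear (numRemovals es) (removalCostFrom-bound [] es emptyWellKeyed valid)
  where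
  emptyWellKeyed : WellKeyed [] []
  emptyWellKeyed = [] , λ ()
  linear : ∀ {x} n → x ≤ n * 8 + potential [] → x ≤ 8 * n
  linear {x} n = subst (x ≤_) (trans (+-identityʳ _) (*-comm n 8))
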